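{- Let $L_c$ be the thrupath: the directed graph with vertex set $\mathbb{N}$ whose edge set is $\{(i,i+1): i\in\mathbb{N}\}$. Let $f$ be the Fibonacci sequence with $f(1)=1$, $f(2)=2$, $f(n)=f(n-1)+f(n-2)$ for $n\ge 3$. Then for every $n\in\mathbb{N}$, $$N(L_c,n)\geq \frac{f(n)}{n^3},$$ and consequently $$R(L_c)\geq \log\frac{\sqrt5+1}{2}.$$
   Context: For a directed graph $G$ with vertex set $\mathbb{N}$ and $n\in\mathbb{N}$, two permutations $\pi,\rho$ of $[n]=\{1,\dots,n\}$ are called $G$-different if there is $i\in[n]$ with $(\pi(i),\rho(i))\in E(G)$. A set of permutations is pairwise $G$-different if every ordered pair of distinct members $(\pi,\rho)$ of it is $G$-different. $N(G,n)$ denotes the largest cardinality of a set of pairwise $G$-different permutations of $[n]$, and the permutation capacity is $R(G)=\lim_{n\to\infty}\frac1n\log N(G,n)$ (this limit exists, possibly infinite). Logarithms are to base 2. -}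

module Defs where

open import Data.Nat using (ℕ; zero; suc; _+_; _*_)
open import Data.Fin using (Fin; toℕ)
open import Data.Fin.Permutation using (Permutation′; _⟨$⟩ʳ_)
open import Data.Product using (Σ; ∃; _×_)
open import Relation.Binary.PropositionalEquality using (_≡_)
open import Relation.Nullary using (¬_)
open import Data.Rational using (ℚ; 1ℚ) renaming (_*_ to _*ℚ_)

DiGraph : Set₁
DiGraph = ℕ → ℕ → Set

thrupath : DiGraph
thrupath i j = j ≡ suc i

-- A permutation of [n] = {1,…,n}, represented on Fin n with value
-- of position i being  suc (toℕ (π ⟨$⟩ʳ i))  ∈ {1,…,n}.
val : {n : ℕ} → Permutation′ n → Fin n → ℕ
val π i = suc (toℕ (π ⟨$⟩ʳ i))

GDifferent : DiGraph → {n : ℕ} → Permutation′ n → Permutation′ n → Set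
GDifferent G {n} π ρ = ∃ λ (i : Fin n) → G (val π i) (val ρ i)

DistinctPerm : {n : ℕ} → Permutation′ n → Permutation′ n → Set
DistinctPerm {n} π ρ = ∃ λ (i : Fin n) → ¬ (π ⟨$⟩ʳ i ≡ ρ ⟨$⟩ʳ i)

PairwiseGDiff : DiGraph → (n k : ℕ) → (Fin k → Permutation′ n) → Set
PairwiseGDiff G n k P =
  (a b : Fin k) → ¬ (a ≡ b) → DistinctPerm (P a) (P b) × GDifferent G (P a) (P b)

-- "N(G,n) ≥ k": there is a set of k pairwise G-different permutations of [n].
NAtLeast : DiGraph → ℕ → ℕ → Set
NAtLeast G n k = Σ (Fin k → Permutation′ n) (PairwiseGDiff G n k)

-- Fibonacci as in the paper: f(1)=1, f(2)=2, f(n)=f(n-1)+f(n-2).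
-- (f 0 = 1 is a dummy value, consistent with the recursion; never used.)
fib : ℕ → ℕ
fib zero = 1
fib (suc zero) = 1
fib (suc (suc zero)) = 2
fib (suc (suc (suc n))) = fib (suc (suc n)) + fib (suc n)

powℚ : ℚ → ℕ → ℚ
powℚ q zero = 1ℚ
powℚ q (suc n) = q *ℚ powℚ q n

-- A tiling of a board of n cells by monominoes and dominoes defines
-- the involution swapping the two cells of each domino, and there are fib n
-- tilings. Weigh a tiling by the number of cells to the right of each of its
-- dominoes. Comparing two distinct tilings of equal weight from the left, one
-- finds a cell i where the second involution exceeds the first by one, i.e. an
-- edge of the thrupath. Weights are below n², so some weight class contains at
-- least fib n / n² tilings.
--
-- For the capacity, write q = a/b; then q² < q + 1 means a² < ab + b², and an
-- induction along the Fibonacci recursion gives aⁿ n² ≤ fib n · bⁿ for large n,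
-- so qⁿ ≤ fib n / n² ≤ N(L_c, n).

module Submission where

open import Defs
open import Data.Nat using (ℕ; _≤_; _*_; _^_)
open import Data.Product using (Σ; ∃; _×_)
open import Data.Integer using (+_)
open import Data.Rational using (ℚ; 0ℚ; 1ℚ; _/_) renaming (_*_ to _*ℚ_; _+_ to _+ℚ_; _<_ to _<ℚ_; _≤_ to _≤ℚ_)

open import Function using (_∘_; it)
open import Data.Bool using (true; false)
open import Data.Empty using (⊥-elim)
open import Data.Product using (_,_; proj₁)
open import Data.Sum using (_⊎_; inj₁; inj₂)
open import Relation.Nullary using (¬_; does; yes; no)
open import Relation.Unary using (Pred; Decidable)
open import Relation.Binary.PropositionalEquality using (_≡_; _≢_; refl; sym; trans; cong; cong₂; subst; subst₂; module ≡-Reasoning)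
open import Data.Nat using (zero; suc; _+_; _<_; _≟_; z≤n; s≤s; z<s; NonZero; >-nonZero; >-nonZero⁻¹)
open import Data.Nat.Properties
open import Data.Nat.Coprimality using (Coprime)
open import Data.Nat.Tactic.RingSolver using (solve-∀)
open import Data.Fin using (Fin; toℕ; fromℕ<)
import Data.Fin as Fin
open import Data.Fin.Properties using (toℕ<n; toℕ-fromℕ<; toℕ-injective)
open import Data.Fin.Permutation using (Permutation′; permutation)
open import Data.List using (List; []; _∷_; [_]; map; _++_; length; filter; lookup)
open import Data.List.Properties using (length-++; length-map; filter-accept)
open import Data.List.Relation.Unary.All as All using (All; []; _∷_)
open import Data.List.Relation.Unary.All.Properties using (all-filter)
open import Data.List.Relation.Unary.AllPairs using ([]; _∷_)
open import Data.List.Relation.Unary.Unique.Propositional using (Unique)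
import Data.List.Relation.Unary.Unique.Propositional.Properties as Unique
open import Data.List.Membership.Propositional using (_∈_)
open import Data.List.Membership.Propositional.Properties using (∈-map⁻; ∈-lookup)
open import Data.Integer as ℤ using (+[1+_]; +≤+; +<+)
import Data.Integer.Properties as ℤ
open import Data.Rational using (mkℚ; toℚᵘ; *<*)
open import Data.Rational.Properties using (toℚᵘ-homo-*; toℚᵘ-homo-+; toℚᵘ-mono-<; toℚᵘ-cancel-≤; toℚᵘ-fromℚᵘ)
open import Data.Rational.Unnormalised as ℚᵘ using (ℚᵘ; mkℚᵘ; 1ℚᵘ; ↥_; ↧ₙ_; _≃_; *≤*; *<*)
import Data.Rational.Unnormalised.Properties as ℚᵘ

n²≤n³ : ∀ n → n * n ≤ n ^ 3
n²≤n³ zero = z≤n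
n²≤n³ n@(suc _) = *-monoʳ-≤ n (m≤m*n n (n * 1))

cancel-common-factor : ∀ {x y f k m} → 0 < m → x * m ≤ f * y → f ≤ k * m → x ≤ k * y
cancel-common-factor {x} {y} {f} {k} {m} 0<m xm≤fy f≤km = *-cancelʳ-≤ x (k * y) m {{ >-nonZero 0<m }} (begin
  x * m        ≤⟨ xm≤fy ⟩
  f * y        ≤⟨ *-monoˡ-≤ y f≤km ⟩
  k * m * y    ≡⟨ *-assoc k m y ⟩
  k * (m * y)  ≡⟨ cong (k *_) (*-comm m y) ⟩
  k * (y * m)  ≡⟨ *-assoc k y m ⟨
  k * y * m    ∎)
  where open ≤-Reasoning

lookup-injective : ∀ {a} {A : Set a} {xs : List A} → Unique xs → ∀ i j → lookup xs i ≡ lookup xs j → i ≡ j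
lookup-injective (_ ∷ _) Fin.zero Fin.zero _ = refl
lookup-injective (x∉ ∷ _) Fin.zero (Fin.suc j) e = ⊥-elim (All.lookup x∉ (∈-lookup j) e)
lookup-injective (x∉ ∷ _) (Fin.suc i) Fin.zero e = ⊥-elim (All.lookup x∉ (∈-lookup i) (sym e))
lookup-injective (_ ∷ u) (Fin.suc i) (Fin.suc j) e = cong Fin.suc (lookup-injective u i j e)

length-filter-∷ : ∀ {a p} {A : Set a} {P : Pred A p} (P? : Decidable P) x xs →
                  length (filter P? (x ∷ xs)) ≡ length (filter P? [ x ]) + length (filter P? xs)
length-filter-∷ P? x xs with does (P? x)
... | true = refl
... | false = refl

sumBelow : ℕ → (ℕ → ℕ) → ℕ
sumBelow zero f = 0
sumBelow (suc B) f = f B + sumBelow B f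

sumBelow-cong : ∀ B {f g : ℕ → ℕ} → (∀ s → f s ≡ g s) → sumBelow B f ≡ sumBelow B g
sumBelow-cong zero f≡g = refl
sumBelow-cong (suc B) f≡g = cong₂ _+_ (f≡g B) (sumBelow-cong B f≡g)

sumBelow-+ : ∀ B (f g : ℕ → ℕ) → sumBelow B (λ s → f s + g s) ≡ sumBelow B f + sumBelow B g
sumBelow-+ zero f g = refl
sumBelow-+ (suc B) f g = begin
  f B + g B + sumBelow B (λ s → f s + g s)   ≡⟨ cong (λ z → f B + g B + z) (sumBelow-+ B f g) ⟩
  f B + g B + (sumBelow B f + sumBelow B g)  ≡⟨ interchange (f B) (g B) (sumBelow B f) (sumBelow B g) ⟩
  f B + sumBelow B f + (g B + sumBelow B g)  ∎
  where
  open ≡-Reasoning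
  interchange : ∀ a b c d → a + b + (c + d) ≡ a + c + (b + d)
  interchange = solve-∀

sumBelow≤*max : ∀ B f → ∃ λ s → sumBelow B f ≤ B * f s
sumBelow≤*max zero f = 0 , z≤n
sumBelow≤*max (suc B) f with sumBelow≤*max B f
... | s , sum≤ with ≤-total (f B) (f s)
...   | inj₁ fB≤fs = s , +-mono-≤ fB≤fs sum≤
...   | inj₂ fs≤fB = B , +-monoʳ-≤ (f B) (≤-trans sum≤ (*-monoʳ-≤ B fs≤fB))

module _ {a} {A : Set a} (w : A → ℕ) where

  ofWeight : ℕ → List A → List A
  ofWeight s = filter (λ x → w x ≟ s)

  1≤sumBelow-ofWeight : ∀ B x → w x < B → 1 ≤ sumBelow B (λ s → length (ofWeight s [ x ]))
  1≤sumBelow-ofWeight (suc B) x wx<1+B with w x ≟ B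
  ... | yes wx≡B = ≤-trans (≤-reflexive (sym (cong length (filter-accept (λ y → w y ≟ B) wx≡B)))) (m≤m+n _ _)
  ... | no wx≢B = begin
    1 ≤⟨ 1≤sumBelow-ofWeight B x (≤∧≢⇒< (≤-pred wx<1+B) wx≢B) ⟩
    sumBelow B (λ s → length (ofWeight s [ x ])) ≤⟨ m≤n+m _ _ ⟩
    length (ofWeight B [ x ]) + sumBelow B (λ s → length (ofWeight s [ x ])) ∎
    where open ≤-Reasoning

  length≤sumBelow-ofWeight : ∀ B xs → All (λ x → w x < B) xs → length xs ≤ sumBelow B (λ s → length (ofWeight s xs))
  length≤sumBelow-ofWeight B [] [] = z≤n
  length≤sumBelow-ofWeight B (x ∷ xs) (wx<B ∷ ws<B) = begin
    suc (length xs) ≤⟨ +-mono-≤ (1≤sumBelow-ofWeight B x wx<B) (length≤sumBelow-ofWeight B xs ws<B) ⟩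
    sumBelow B (λ s → length (ofWeight s [ x ])) + sumBelow B (λ s → length (ofWeight s xs))
      ≡⟨ sumBelow-+ B (λ s → length (ofWeight s [ x ])) (λ s → length (ofWeight s xs)) ⟨
    sumBelow B (λ s → length (ofWeight s [ x ]) + length (ofWeight s xs))
      ≡⟨ sumBelow-cong B (λ s → sym (length-filter-∷ (λ y → w y ≟ s) x xs)) ⟩
    sumBelow B (λ s → length (ofWeight s (x ∷ xs))) ∎
    where open ≤-Reasoning

  pigeonhole : ∀ B xs → All (λ x → w x < B) xs → ∃ λ s → length xs ≤ B * length (ofWeight s xs)
  pigeonhole B xs ws<B with sumBelow≤*max B (λ s → length (ofWeight s xs))
  ... | s , sum≤ = s , ≤-trans (length≤sumBelow-ofWeight B xs ws<B) sum≤

fib-suc-suc : ∀ n → fib (suc (suc n)) ≡ fib (suc n) + fib n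
fib-suc-suc zero = refl
fib-suc-suc (suc n) = refl

data Tiling : ℕ → Set where
  empty  : Tiling 0
  mono   : ∀ {n} → Tiling n → Tiling (suc n)
  domino : ∀ {n} → Tiling n → Tiling (suc (suc n))

-- Cells are numbered from 0.
act : ∀ {n} → Tiling n → ℕ → ℕ
act empty i = i
act (mono t) zero = zero
act (mono t) (suc i) = suc (act t i)
act (domino t) zero = 1
act (domino t) (suc zero) = 0
act (domino t) (suc (suc i)) = suc (suc (act t i))

act-involutive : ∀ {n} (t : Tiling n) i → act t (act t i) ≡ i
act-involutive empty i = refl
act-involutive (mono t) zero = refl
act-involutive (mono t) (suc i) = cong suc (act-involutive t i)
act-involutive (domino t) zero = refl
act-involutive (domino t) (suc zero) = refl
act-involutive (domino t) (suc (suc i)) = cong (suc ∘ suc) (act-involutive t i)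

act-< : ∀ {n} (t : Tiling n) {i} → i < n → act t i < n
act-< (mono t) {zero} _ = z<s
act-< (mono t) {suc i} (s≤s i<n) = s≤s (act-< t i<n)
act-< (domino t) {zero} _ = s≤s z<s
act-< (domino t) {suc zero} _ = z<s
act-< (domino t) {suc (suc i)} (s≤s (s≤s i<n)) = s≤s (s≤s (act-< t i<n))

weight : ∀ {n} → Tiling n → ℕ
weight empty = 0
weight (mono t) = weight t
weight (domino {n} t) = n + weight t

toPermutation : ∀ {n} → Tiling n → Permutation′ n
toPermutation {n} t = permutation actFin actFin actFin-involutive actFin-involutive
  where
  actFin : Fin n → Fin n
  actFin i = fromℕ< (act-< t (toℕ<n i))
  actFin-involutive : ∀ i → actFin (actFin i) ≡ i
  actFin-involutive i = toℕ-injective (begin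
    toℕ (actFin (actFin i)) ≡⟨ toℕ-fromℕ< _ ⟩
    act t (toℕ (actFin i))  ≡⟨ cong (act t) (toℕ-fromℕ< _) ⟩
    act t (act t (toℕ i))   ≡⟨ act-involutive t (toℕ i) ⟩
    toℕ i                   ∎)
    where open ≡-Reasoning

val-toPermutation : ∀ {n} (t : Tiling n) i → val (toPermutation t) i ≡ suc (act t (toℕ i))
val-toPermutation t i = cong suc (toℕ-fromℕ< _)

tilings : (n : ℕ) → List (Tiling n)
tilings zero = [ empty ]
tilings (suc zero) = [ mono empty ]
tilings (suc (suc n)) = map mono (tilings (suc n)) ++ map domino (tilings n)

length-tilings : ∀ n → length (tilings n) ≡ fib n
length-tilings zero = refl
length-tilings (suc zero) = refl
length-tilings (suc (suc n)) = begin
  length (map mono (tilings (suc n)) ++ map domino (tilings n))    ≡⟨ length-++ (map mono (tilings (suc n))) ⟩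
  length (map mono (tilings (suc n))) + length (map domino (tilings n))
    ≡⟨ cong₂ _+_ (length-map mono (tilings (suc n))) (length-map domino (tilings n)) ⟩
  length (tilings (suc n)) + length (tilings n)                  ≡⟨ cong₂ _+_ (length-tilings (suc n)) (length-tilings n) ⟩
  fib (suc n) + fib n                                            ≡⟨ fib-suc-suc n ⟨
  fib (suc (suc n))                                              ∎
  where open ≡-Reasoning

tilings-unique : ∀ n → Unique (tilings n)
tilings-unique zero = [] ∷ []
tilings-unique (suc zero) = [] ∷ []
tilings-unique (suc (suc n)) =
  Unique.++⁺ (Unique.map⁺ mono-injective (tilings-unique (suc n))) (Unique.map⁺ domino-injective (tilings-unique n)) disjoint
  where
  mono-injective : ∀ {m} {t t′ : Tiling m} → mono t ≡ mono t′ → t ≡ t′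
  mono-injective refl = refl
  domino-injective : ∀ {m} {t t′ : Tiling m} → domino t ≡ domino t′ → t ≡ t′
  domino-injective refl = refl
  disjoint : ∀ {t} → ¬ (t ∈ map mono (tilings (suc n)) × t ∈ map domino (tilings n))
  disjoint (t∈monos , t∈dominos) with ∈-map⁻ mono t∈monos | ∈-map⁻ domino t∈dominos
  ... | _ , _ , refl | _ , _ , ()

weight+n≤n² : ∀ {n} (t : Tiling n) → weight t + n ≤ n * n
weight+n≤n² empty = z≤n
weight+n≤n² (mono {m} t) = begin
  weight t + suc m    ≡⟨ +-suc (weight t) m ⟩
  suc (weight t + m)  ≤⟨ s≤s (weight+n≤n² t) ⟩
  suc (m * m)         ≤⟨ s≤s (m≤n+m (m * m) m) ⟩
  suc (m + m * m)     ≤⟨ s≤s (+-monoʳ-≤ m (*-monoʳ-≤ m (n≤1+n m))) ⟩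
  suc m * suc m       ∎
  where open ≤-Reasoning
weight+n≤n² (domino {m} t) = begin
  m + weight t + suc (suc m)         ≡⟨ shuffle m (weight t) ⟩
  (weight t + m) + suc (suc m)       ≤⟨ +-monoˡ-≤ (suc (suc m)) (weight+n≤n² t) ⟩
  m * m + suc (suc m)                ≤⟨ m≤m+n _ (3 * m + 2) ⟩
  m * m + suc (suc m) + (3 * m + 2)  ≡⟨ square m ⟨
  suc (suc m) * suc (suc m)          ∎
  where
  open ≤-Reasoning
  shuffle : ∀ m w → m + w + suc (suc m) ≡ (w + m) + suc (suc m)
  shuffle = solve-∀
  square : ∀ m → suc (suc m) * suc (suc m) ≡ m * m + suc (suc m) + (3 * m + 2)
  square = solve-∀

weight<n² : ∀ {n} → 1 ≤ n → (t : Tiling n) → weight t < n * n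
weight<n² 1≤n t = <-≤-trans (m<m+n (weight t) 1≤n) (weight+n≤n² t)

EdgeBelow : ℕ → (ℕ → ℕ) → (ℕ → ℕ) → Set
EdgeBelow n f g = ∃ λ i → i < n × g i ≡ suc (f i)

EdgeBelow-shift : ∀ {n f g f′ g′} k c → (∀ i → f′ (k + i) ≡ c + f i) → (∀ i → g′ (k + i) ≡ c + g i) →
                  EdgeBelow n f g → EdgeBelow (k + n) f′ g′
EdgeBelow-shift {f = f} {g} {f′} {g′} k c f′≡ g′≡ (i , i<n , gi≡) = k + i , +-monoʳ-< k i<n , (begin
  g′ (k + i)        ≡⟨ g′≡ i ⟩
  c + g i           ≡⟨ cong (λ z → c + z) gi≡ ⟩
  c + suc (f i)     ≡⟨ +-suc c (f i) ⟩
  suc (c + f i)     ≡⟨ cong suc (f′≡ i) ⟨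
  suc (f′ (k + i))  ∎)
  where open ≡-Reasoning

-- At the first cell where t and t′ differ, a monomino of t facing a domino of t′
-- is an edge. In the opposite case t′ must start its next domino strictly
-- further right than t does, which makes t′ lighter unless an edge occurs later.
mutual
  edge-or-lighter : ∀ {n} (t t′ : Tiling n) → EdgeBelow n (act t) (act t′) ⊎ t ≡ t′ ⊎ weight t′ < weight t
  edge-or-lighter empty empty = inj₂ (inj₁ refl)
  edge-or-lighter (mono t) (mono t′) with edge-or-lighter t t′
  ... | inj₁ e = inj₁ (EdgeBelow-shift 1 1 (λ _ → refl) (λ _ → refl) e)
  ... | inj₂ (inj₁ refl) = inj₂ (inj₁ refl)
  ... | inj₂ (inj₂ lt) = inj₂ (inj₂ lt)
  edge-or-lighter (domino {m} t) (domino t′) with edge-or-lighter t t′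
  ... | inj₁ e = inj₁ (EdgeBelow-shift 2 2 (λ _ → refl) (λ _ → refl) e)
  ... | inj₂ (inj₁ refl) = inj₂ (inj₁ refl)
  ... | inj₂ (inj₂ lt) = inj₂ (inj₂ (+-monoʳ-< m lt))
  edge-or-lighter (mono t) (domino t′) = inj₁ (0 , z<s , refl)
  edge-or-lighter (domino t) (mono t′) with domino-vs-mono t t′
  ... | inj₁ e = inj₁ (EdgeBelow-shift 1 0 (λ _ → refl) (λ _ → refl) e)
  ... | inj₂ lt = inj₂ (inj₂ lt)

  domino-vs-mono : ∀ {m} (t : Tiling m) (t′ : Tiling (suc m)) →
    EdgeBelow (suc m) (act (domino t) ∘ suc) (act (mono t′) ∘ suc) ⊎ weight (mono t′) < weight (domino t)
  domino-vs-mono t (mono t′) = inj₁ (0 , z<s , refl)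
  domino-vs-mono (mono {j} t) (domino t′) with edge-or-lighter t t′
  ... | inj₁ e = inj₁ (EdgeBelow-shift 2 3 (λ _ → refl) (λ _ → refl) e)
  ... | inj₂ (inj₁ refl) = inj₂ (n<1+n (j + weight t))
  ... | inj₂ (inj₂ lt) = inj₂ (m<n⇒m<1+n (+-monoʳ-< j lt))
  domino-vs-mono (domino {l} t) (domino t′) with domino-vs-mono t t′
  ... | inj₁ e = inj₁ (EdgeBelow-shift 2 2 (λ _ → refl) (λ _ → refl) e)
  ... | inj₂ lt = inj₂ (s≤s (m<n⇒m<1+n (+-monoʳ-< l lt)))

equal-weight⇒EdgeBelow : ∀ {n} {t t′ : Tiling n} → t ≢ t′ → weight t ≡ weight t′ → EdgeBelow n (act t) (act t′)
equal-weight⇒EdgeBelow {t = t} {t′} t≢t′ w≡w′ with edge-or-lighter t t′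
... | inj₁ e = e
... | inj₂ (inj₁ t≡t′) = ⊥-elim (t≢t′ t≡t′)
... | inj₂ (inj₂ w′<w) = ⊥-elim (<-irrefl (sym w≡w′) w′<w)

thrupath-different⇒distinct : ∀ {n} (π ρ : Permutation′ n) → GDifferent thrupath π ρ → DistinctPerm π ρ
thrupath-different⇒distinct π ρ (i , edge) = i , λ πi≡ρi → 1+n≢n (sym (trans edge (cong (suc ∘ suc ∘ toℕ) πi≡ρi)))

EdgeBelow⇒thrupath-different : ∀ {n} {t t′ : Tiling n} → EdgeBelow n (act t) (act t′) →
                               GDifferent thrupath (toPermutation t) (toPermutation t′)
EdgeBelow⇒thrupath-different {n} {t} {t′} (i , i<n , e) = j , (begin
  val (toPermutation t′) j  ≡⟨ val-toPermutation t′ j ⟩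
  suc (act t′ (toℕ j))      ≡⟨ cong (suc ∘ act t′) (toℕ-fromℕ< i<n) ⟩
  suc (act t′ i)            ≡⟨ cong suc e ⟩
  suc (suc (act t i))       ≡⟨ cong (suc ∘ suc ∘ act t) (toℕ-fromℕ< i<n) ⟨
  suc (suc (act t (toℕ j))) ≡⟨ cong suc (val-toPermutation t j) ⟨
  suc (val (toPermutation t) j) ∎)
  where
  open ≡-Reasoning
  j : Fin n
  j = fromℕ< i<n

equal-weight-family : ∀ {n s} (ts : List (Tiling n)) → Unique ts → All (λ t → weight t ≡ s) ts →
                      NAtLeast thrupath n (length ts)
equal-weight-family {n} ts unique weights = toPermutation ∘ lookup ts , different
  where
  different : PairwiseGDiff thrupath n (length ts) (toPermutation ∘ lookup ts)
  different a b a≢b = thrupath-different⇒distinct π ρ edge , edge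
    where
    π ρ : Permutation′ n
    π = toPermutation (lookup ts a)
    ρ = toPermutation (lookup ts b)
    edge : GDifferent thrupath π ρ
    edge = EdgeBelow⇒thrupath-different (equal-weight⇒EdgeBelow
      (a≢b ∘ lookup-injective unique a b)
      (trans (All.lookup weights (∈-lookup a)) (sym (All.lookup weights (∈-lookup b)))))

N≥fib/n² : ∀ n → 1 ≤ n → Σ ℕ λ k → NAtLeast thrupath n k × fib n ≤ k * (n * n)
N≥fib/n² n 1≤n with pigeonhole weight (n * n) (tilings n) (All.tabulate (λ {t} _ → weight<n² 1≤n t))
... | s , fib≤ = length largestClass , equal-weight-family largestClass unique same-weight , (begin
  fib n                          ≡⟨ length-tilings n ⟨
  length (tilings n)             ≤⟨ fib≤ ⟩
  n * n * length largestClass    ≡⟨ *-comm (n * n) (length largestClass) ⟩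
  length largestClass * (n * n)  ∎)
  where
  open ≤-Reasoning
  largestClass : List (Tiling n)
  largestClass = ofWeight weight s (tilings n)
  unique : Unique largestClass
  unique = Unique.filter⁺ (λ t → weight t ≟ s) (tilings-unique n)
  same-weight : All (λ t → weight t ≡ s) largestClass
  same-weight = all-filter (λ t → weight t ≟ s) (tilings n)

cube-step : ∀ A m → 26 * A ≤ m → 1 ≤ m → A * (2 + m) ^ 3 ≤ suc A * m ^ 3
cube-step A m 26A≤m 1≤m = begin
  A * (2 + m) ^ 3                               ≡⟨ expand A m ⟩
  A * m ^ 3 + A * (6 * (m * m) + 12 * m + 8)    ≤⟨ +-monoʳ-≤ (A * m ^ 3) (*-monoʳ-≤ A lower-order) ⟩
  A * m ^ 3 + A * (26 * (m * m))                ≡⟨ cong (λ z → A * m ^ 3 + z) (regroup A m) ⟩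
  A * m ^ 3 + 26 * A * (m * m)                  ≤⟨ +-monoʳ-≤ (A * m ^ 3) (*-monoˡ-≤ (m * m) 26A≤m) ⟩
  A * m ^ 3 + m * (m * m)                       ≡⟨ factor A m ⟩
  suc A * m ^ 3                                 ∎
  where
  open ≤-Reasoning
  m≤m² : m ≤ m * m
  m≤m² = m≤m*n m m {{ >-nonZero 1≤m }}
  lower-order : 6 * (m * m) + 12 * m + 8 ≤ 26 * (m * m)
  lower-order = ≤-trans (+-mono-≤ (+-monoʳ-≤ (6 * (m * m)) (*-monoʳ-≤ 12 m≤m²)) (*-monoʳ-≤ 8 (*-mono-≤ 1≤m 1≤m)))
                        (≤-reflexive (collect m))
    where
    collect : ∀ m → 6 * (m * m) + 12 * (m * m) + 8 * (m * m) ≡ 26 * (m * m)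
    collect = solve-∀
  expand : ∀ A m → A * ((2 + m) * ((2 + m) * ((2 + m) * 1))) ≡ A * (m * (m * (m * 1))) + A * (6 * (m * m) + 12 * m + 8)
  expand = solve-∀
  regroup : ∀ A m → A * (26 * (m * m)) ≡ 26 * A * (m * m)
  regroup = solve-∀
  factor : ∀ A m → A * (m * (m * (m * 1))) + m * (m * m) ≡ (1 + A) * (m * (m * (m * 1)))
  factor = solve-∀

-- The invariant aⁿ (n + c)³ ≤ E · fib n · bⁿ propagates along the Fibonacci
-- recursion: a² < ab + b² leaves room for the factor ((m + 2)/m)³, which is at
-- most 1 + 1/a² by the choice of c; E is chosen so that the invariant holds at 0 and 1.
module _ (a b : ℕ) .{{_ : NonZero a}} .{{_ : NonZero b}} (a²<ab+b² : a * a < a * b + b * b) where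

  private
    c : ℕ
    c = 26 * (a * a)

    E : ℕ
    E = a * suc c ^ 3

    Invariant : ℕ → Set
    Invariant n = a ^ n * (n + c) ^ 3 ≤ E * (fib n * b ^ n)

    invariant-0 : Invariant 0
    invariant-0 = begin
      1 * c ^ 3       ≡⟨ *-identityˡ _ ⟩
      c ^ 3           ≤⟨ ^-monoˡ-≤ 3 (n≤1+n c) ⟩
      suc c ^ 3       ≤⟨ m≤n*m (suc c ^ 3) a ⟩
      E               ≡⟨ *-identityʳ E ⟨
      E * (1 * 1)     ∎
      where open ≤-Reasoning

    invariant-1 : Invariant 1
    invariant-1 = begin
      a * 1 * suc c ^ 3  ≡⟨ cong (_* suc c ^ 3) (*-identityʳ a) ⟩
      E                  ≤⟨ m≤m*n E b ⟩
      E * b              ≡⟨ cong (E *_) (*-identityʳ b) ⟨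
      E * (b * 1)        ≡⟨ cong (E *_) (*-identityˡ (b * 1)) ⟨
      E * (1 * (b * 1))  ∎
      where open ≤-Reasoning

    invariant-step : ∀ n → Invariant n → Invariant (suc n) → Invariant (suc (suc n))
    invariant-step n inv₀ inv₁ = begin
      a * (a * a ^ n) * (2 + m) ^ 3                 ≡⟨ shuffle₁ a (a ^ n) ((2 + m) ^ 3) ⟩
      a ^ n * (a * a * (2 + m) ^ 3)                 ≤⟨ *-monoʳ-≤ (a ^ n) (cube-step (a * a) m (m≤n+m c n) 1≤m) ⟩
      a ^ n * (suc (a * a) * m ^ 3)                 ≤⟨ *-monoʳ-≤ (a ^ n) (*-monoˡ-≤ (m ^ 3) a²<ab+b²) ⟩
      a ^ n * ((a * b + b * b) * m ^ 3)             ≡⟨ shuffle₂ a b (a ^ n) (m ^ 3) ⟩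
      b * (a * a ^ n * m ^ 3) + b * b * (a ^ n * m ^ 3)
        ≤⟨ +-mono-≤ (*-monoʳ-≤ b (≤-trans (*-monoʳ-≤ (a * a ^ n) (^-monoˡ-≤ 3 (n≤1+n m))) inv₁)) (*-monoʳ-≤ (b * b) inv₀) ⟩
      b * (E * (fib (suc n) * (b * b ^ n))) + b * b * (E * (fib n * b ^ n))
        ≡⟨ shuffle₃ b E (fib (suc n)) (fib n) (b ^ n) ⟩
      E * ((fib (suc n) + fib n) * (b * (b * b ^ n))) ≡⟨ cong (λ f → E * (f * (b * (b * b ^ n)))) (fib-suc-suc n) ⟨
      E * (fib (suc (suc n)) * (b * (b * b ^ n)))   ∎
      where
      open ≤-Reasoning
      m : ℕ
      m = n + c
      1≤m : 1 ≤ m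
      1≤m = ≤-trans (*-mono-≤ {1} {26} (s≤s z≤n) (*-mono-≤ (>-nonZero⁻¹ a) (>-nonZero⁻¹ a))) (m≤n+m c n)
      shuffle₁ : ∀ a x y → a * (a * x) * y ≡ x * (a * a * y)
      shuffle₁ = solve-∀
      shuffle₂ : ∀ a b x y → x * ((a * b + b * b) * y) ≡ b * (a * x * y) + b * b * (x * y)
      shuffle₂ = solve-∀
      shuffle₃ : ∀ b E F₁ F₀ y → b * (E * (F₁ * (b * y))) + b * b * (E * (F₀ * y)) ≡ E * ((F₁ + F₀) * (b * (b * y)))
      shuffle₃ = solve-∀

    invariant : ∀ n → Invariant n × Invariant (suc n)
    invariant zero = invariant-0 , invariant-1
    invariant (suc n) with invariant n
    ... | inv₀ , inv₁ = inv₁ , invariant-step n inv₀ inv₁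

  fib-dominates : ∃ λ n₀ → ∀ n → n₀ ≤ n → a ^ n * (n * n) ≤ fib n * b ^ n
  fib-dominates = E , λ n E≤n → *-cancelˡ-≤ E {{ E-nonZero }} (begin
    E * (a ^ n * (n * n))  ≤⟨ *-monoˡ-≤ (a ^ n * (n * n)) E≤n ⟩
    n * (a ^ n * (n * n))  ≡⟨ shuffle n (a ^ n) ⟩
    a ^ n * n ^ 3          ≤⟨ *-monoʳ-≤ (a ^ n) (^-monoˡ-≤ 3 (m≤m+n n c)) ⟩
    a ^ n * (n + c) ^ 3    ≤⟨ proj₁ (invariant n) ⟩
    E * (fib n * b ^ n)    ∎)
    where
    open ≤-Reasoning
    E-nonZero : NonZero E
    E-nonZero = m*n≢0 a (suc c ^ 3) {{ it }} {{ m^n≢0 (suc c) 3 }}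
    shuffle : ∀ n x → n * (x * (n * n)) ≡ x * (n * (n * (n * 1)))
    shuffle = solve-∀

powᵘ : ℚᵘ → ℕ → ℚᵘ
powᵘ p zero = 1ℚᵘ
powᵘ p (suc n) = p ℚᵘ.* powᵘ p n

toℚᵘ-powℚ : ∀ q n → toℚᵘ (powℚ q n) ≃ powᵘ (toℚᵘ q) n
toℚᵘ-powℚ q zero = ℚᵘ.≃-refl
toℚᵘ-powℚ q (suc n) = ℚᵘ.≃-trans (toℚᵘ-homo-* q (powℚ q n)) (ℚᵘ.*-congˡ {toℚᵘ q} (toℚᵘ-powℚ q n))

↥-* : ∀ p q → ↥ (p ℚᵘ.* q) ≡ (↥ p) ℤ.* (↥ q)
↥-* (mkℚᵘ _ _) (mkℚᵘ _ _) = refl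

↧ₙ-* : ∀ p q → ↧ₙ (p ℚᵘ.* q) ≡ ↧ₙ p * ↧ₙ q
↧ₙ-* (mkℚᵘ _ _) (mkℚᵘ _ _) = refl

↥-powᵘ : ∀ {p a} n → ↥ p ≡ + a → ↥ powᵘ p n ≡ + (a ^ n)
↥-powᵘ zero _ = refl
↥-powᵘ {p} {a} (suc n) ↥p≡a = begin
  ↥ (p ℚᵘ.* powᵘ p n)     ≡⟨ ↥-* p (powᵘ p n) ⟩
  ↥ p ℤ.* ↥ powᵘ p n      ≡⟨ cong₂ ℤ._*_ ↥p≡a (↥-powᵘ n ↥p≡a) ⟩
  + a ℤ.* + (a ^ n)       ≡⟨ ℤ.pos-* a (a ^ n) ⟨
  + (a * a ^ n)           ∎
  where open ≡-Reasoning

↧ₙ-powᵘ : ∀ p n → ↧ₙ powᵘ p n ≡ ↧ₙ p ^ n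
↧ₙ-powᵘ p zero = refl
↧ₙ-powᵘ p (suc n) = trans (↧ₙ-* p (powᵘ p n)) (cong (↧ₙ p *_) (↧ₙ-powᵘ p n))

powℚ≤ : ∀ a d .(c : Coprime a (suc d)) n k → a ^ n ≤ k * suc d ^ n → powℚ (mkℚ (+ a) d c) n ≤ℚ + k / 1
powℚ≤ a d c n k aⁿ≤kbⁿ = toℚᵘ-cancel-≤
  (ℚᵘ.≤-respˡ-≃ (ℚᵘ.≃-sym (toℚᵘ-powℚ q n)) (ℚᵘ.≤-respʳ-≃ (ℚᵘ.≃-sym (toℚᵘ-fromℚᵘ (mkℚᵘ (+ k) 0))) powᵘ≤k))
  where
  q : ℚ
  q = mkℚ (+ a) d c
  powᵘ≤k : powᵘ (toℚᵘ q) n ℚᵘ.≤ mkℚᵘ (+ k) 0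
  powᵘ≤k = *≤* (subst₂ (λ x y → x ℤ.* + 1 ℤ.≤ + k ℤ.* + y)
    (sym (↥-powᵘ n refl)) (sym (↧ₙ-powᵘ (toℚᵘ q) n))
    (subst₂ ℤ._≤_ (ℤ.pos-* (a ^ n) 1) (ℤ.pos-* k (suc d ^ n)) (+≤+ (subst (_≤ k * suc d ^ n) (sym (*-identityʳ _)) aⁿ≤kbⁿ))))

q²<q+1⇒a²<ab+b² : ∀ a d .(c : Coprime (suc a) (suc d)) → let q = mkℚ +[1+ a ] d c in q *ℚ q <ℚ q +ℚ 1ℚ →
                  suc a * suc a < suc a * suc d + suc d * suc d
q²<q+1⇒a²<ab+b² a d c q²<q+1 = clear-denominators
  (ℚᵘ.<-respˡ-≃ (toℚᵘ-homo-* q q) (ℚᵘ.<-respʳ-≃ q+1≃ (toℚᵘ-mono-< q²<q+1)))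
  where
  q : ℚ
  q = mkℚ +[1+ a ] d c
  q+1≃ : toℚᵘ (q +ℚ 1ℚ) ≃ toℚᵘ q ℚᵘ.+ 1ℚᵘ
  q+1≃ = ℚᵘ.≃-trans (toℚᵘ-homo-+ q 1ℚ) (ℚᵘ.+-congʳ (toℚᵘ q) (toℚᵘ-fromℚᵘ 1ℚᵘ))
  clear-denominators : toℚᵘ q ℚᵘ.* toℚᵘ q ℚᵘ.< toℚᵘ q ℚᵘ.+ 1ℚᵘ → suc a * suc a < suc a * suc d + suc d * suc d
  clear-denominators (*<* (+<+ lt)) =
    *-cancelʳ-< (suc d) _ _ (subst₂ _<_ (left (suc a) (suc d)) (right (suc a) (suc d)) lt)
    where
    left : ∀ a b → a * a * (b * 1) ≡ a * a * b
    left = solve-∀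
    right : ∀ a b → (a * 1 + 1 * b) * (b * b) ≡ (a * b + b * b) * b
    right = solve-∀

N≥powℚ : ∀ a d .(c : Coprime a (suc d)) n → 1 ≤ n → a ^ n * (n * n) ≤ fib n * suc d ^ n →
         Σ ℕ λ k → NAtLeast thrupath n k × powℚ (mkℚ (+ a) d c) n ≤ℚ (+ k) / 1
N≥powℚ a d c n 1≤n aⁿn²≤fib·bⁿ =
  let k , family , fib≤kn² = N≥fib/n² n 1≤n
  in k , family , powℚ≤ a d c n k (cancel-common-factor {a ^ n} {suc d ^ n} {fib n} {k} (*-mono-≤ 1≤n 1≤n) aⁿn²≤fib·bⁿ fib≤kn²)

proposition2 : ((n : ℕ) → 1 ≤ n → Σ ℕ λ k → NAtLeast thrupath n k × fib n ≤ k * (n ^ 3))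
    × ((q : ℚ) → 0ℚ <ℚ q → q *ℚ q <ℚ q +ℚ 1ℚ →
        ∃ λ (n₀ : ℕ) → (n : ℕ) → n₀ ≤ n →
          Σ ℕ λ k → NAtLeast thrupath n k × powℚ q n ≤ℚ (+ k) / 1)
proposition2 = fib/n³-bound , capacity-bound
  where
  fib/n³-bound : (n : ℕ) → 1 ≤ n → Σ ℕ λ k → NAtLeast thrupath n k × fib n ≤ k * (n ^ 3)
  fib/n³-bound n 1≤n =
    let k , family , fib≤kn² = N≥fib/n² n 1≤n
    in k , family , ≤-trans fib≤kn² (*-monoʳ-≤ k (n²≤n³ n))

  capacity-bound : (q : ℚ) → 0ℚ <ℚ q → q *ℚ q <ℚ q +ℚ 1ℚ →
                   ∃ λ (n₀ : ℕ) → (n : ℕ) → n₀ ≤ n → Σ ℕ λ k → NAtLeast thrupath n k × powℚ q n ≤ℚ (+ k) / 1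
  capacity-bound (mkℚ +[1+ a ] d c) _ q²<q+1 =
    let n₀ , dominated = fib-dominates (suc a) (suc d) (q²<q+1⇒a²<ab+b² a d c q²<q+1)
    in suc n₀ , λ n n₀<n → N≥powℚ (suc a) d c n (≤-trans (s≤s z≤n) n₀<n) (dominated n (<⇒≤ n₀<n))
  capacity-bound (mkℚ (+ zero) _ _) (*<* (+<+ ())) _
  capacity-bound (mkℚ ℤ.-[1+ _ ] _ _) (*<* ()) _
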